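{- Let $n\ge3$, $p\in[1,2n-2]$ and $\gamma\in P(n-2,n)$ with $|\gamma|\le 2n-3$ and $p+|\gamma|>2n-3$. If $\gamma^*:=(\gamma_1+p+1,\gamma_2-1)\in P(n-2,n)$, then $\gamma\to\gamma^*$.
   Context: $P(n-2,n)$ is the set of partitions $\gamma=(\gamma_1,\gamma_2)$ inside a $2\times(2n-2)$ rectangle that are $(n-2)$-strict ($\gamma_1>\gamma_2$ whenever $\gamma_1>n-2$). Boxes are $(r:c)$ (row $r$, column $c$). $(r:c)$ is related to $(r':c')$ if $|c-(n-1)|+r=|c'-(n-1)|+r'$. For $|\delta|=|\gamma|+p$, the relation $\gamma\to\delta$ holds if $\delta$ can be obtained from $\gamma$ by removing a vertical strip (at most one box per row) from the first $n-2$ columns of $\gamma$ and then adding a horizontal strip (at most one box per column), such that (1) each box of $\gamma$ in the first $n-2$ columns having no box of $\delta$ below it is related to at most one box of $\delta\setminus\gamma$; and (2) every box of $\gamma\setminus\delta$, and the box above it, is each related to exactly one box of $\delta\setminus\gamma$, and these boxes of $\delta\setminus\gamma$ all lie in the same row. -}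

module Defs where

open import Data.Nat using (ℕ; zero; suc; _+_; _*_; _∸_; _≤_; _<_; ∣_-_∣)
open import Data.Product using (Σ; _×_; _,_; proj₁; proj₂)
open import Data.Sum using (_⊎_)
open import Relation.Nullary using (¬_)
open import Relation.Binary.PropositionalEquality using (_≡_)

-- A shape with at most two rows: (λ₁ , λ₂), row lengths.
Shape : Set
Shape = ℕ × ℕ

size : Shape → ℕ
size (a , b) = a + b

rowLen : Shape → ℕ → ℕ
rowLen (a , b) 1 = a
rowLen (a , b) 2 = b
rowLen _ _ = 0

-- a box (r : c) = (row , column), both 1-indexed
Box : Set
Box = ℕ × ℕ

row col : Box → ℕ
row = proj₁
col = proj₂

_∈ₛ_ : Box → Shape → Set
(r , c) ∈ₛ λ' = 1 ≤ c × c ≤ rowLen λ' r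

_∈_∖_ : Box → Shape → Shape → Set
b ∈ λ' ∖ μ = b ∈ₛ λ' × ¬ (b ∈ₛ μ)

_⊆ₛ_ : Shape → Shape → Set
μ ⊆ₛ λ' = ∀ b → b ∈ₛ μ → b ∈ₛ λ'

IsPartition : Shape → Set
IsPartition (a , b) = b ≤ a

-- γ ∈ P(n-2,n): partition inside a 2 × (2n-2) rectangle, (n-2)-strict
InP : ℕ → Shape → Set
InP n (a , b) = b ≤ a × a ≤ 2 * n ∸ 2 × (n ∸ 2 < a → b < a)

Related : ℕ → Box → Box → Set
Related n (r , c) (r' , c') = ∣ c - (n ∸ 1) ∣ + r ≡ ∣ c' - (n ∸ 1) ∣ + r'

VStrip : Shape → Shape → Set
VStrip λ' μ = ∀ r c c' → (r , c) ∈ λ' ∖ μ → (r , c') ∈ λ' ∖ μ → c ≡ c'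

HStrip : Shape → Shape → Set
HStrip λ' μ = ∀ r r' c → (r , c) ∈ λ' ∖ μ → (r' , c) ∈ λ' ∖ μ → r ≡ r'

InFirstCols : ℕ → Shape → Shape → Set
InFirstCols k λ' μ = ∀ b → b ∈ λ' ∖ μ → col b ≤ k

Cond1 : ℕ → Shape → Shape → Set
Cond1 n γ δ = ∀ r c → (r , c) ∈ₛ γ → c ≤ n ∸ 2 → ¬ ((suc r , c) ∈ₛ δ) →
  ∀ x y → x ∈ δ ∖ γ → y ∈ δ ∖ γ →
  Related n (r , c) x → Related n (r , c) y → x ≡ y

SelfOrAbove : Box → Box → Set
SelfOrAbove (r , c) b' = b' ≡ (r , c) ⊎ (2 ≤ r × b' ≡ (r ∸ 1 , c))

Cond2 : ℕ → Shape → Shape → Set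
Cond2 n γ δ = Σ ℕ λ ρ → ∀ b → b ∈ γ ∖ δ → ∀ b' → SelfOrAbove b b' →
  Σ Box λ x → (x ∈ δ ∖ γ × Related n b' x × row x ≡ ρ) ×
    (∀ y → y ∈ δ ∖ γ → Related n b' y → y ≡ x)

Arrow : ℕ → ℕ → Shape → Shape → Set
Arrow n p γ δ = size δ ≡ size γ + p ×
  Σ Shape λ μ → IsPartition μ × μ ⊆ₛ γ × VStrip γ μ × InFirstCols (n ∸ 2) γ μ ×
    μ ⊆ₛ δ × HStrip δ μ × Cond1 n γ δ × Cond2 n γ δ

module Submission where

-- The witness is the intermediate shape μ = (g , h): one removes the last
-- box (2 : h + 1) of the second row of γ (a vertical strip, lying in the
-- first n - 2 columns because the size bound forces h + 1 < n - 1) and adds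
-- the boxes (1 : g + 1) … (1 : g + p + 1) to the first row (a horizontal
-- strip).  Writing D = n - 1 for the centre column, the "level" of a box
-- (r : c) is |c - D| + r, and two boxes are related iff their levels agree.  This gives condition (1) and the uniqueness half of
-- condition (2); the existence half is an explicit new box in row 1, which
-- lies in the window g < c ≤ g + p + 1 exactly because of the two bounds on
-- |γ| in the hypotheses.

open import Defs
open import Data.Nat using (ℕ; zero; suc; _+_; _*_; _∸_; _≤_; _<_; z≤n; s≤s; ∣_-_∣; _≤?_)
open import Data.Nat.Properties
open import Data.Nat.Solver using (module +-*-Solver)
open import Algebra.Properties.CommutativeSemigroup +-commutativeSemigroup using (interchange)
open import Data.Product using (_,_; Σ; _×_; proj₁; proj₂)
open import Data.Sum using (inj₁; inj₂)
open import Data.Empty using (⊥-elim)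
open import Relation.Nullary using (yes; no)
open import Relation.Binary.PropositionalEquality

left-distance : ∀ {c D} → c ≤ D → ∣ c - D ∣ + c ≡ D
left-distance {c} {D} c≤D = begin
  ∣ c - D ∣ + c ≡⟨ cong (_+ c) (m≤n⇒∣m-n∣≡n∸m c≤D) ⟩
  D ∸ c + c     ≡⟨ m∸n+n≡m c≤D ⟩
  D             ∎
  where open ≡-Reasoning

right-distance : ∀ {c D} → D ≤ c → D + ∣ c - D ∣ ≡ c
right-distance {c} {D} D≤c = begin
  D + ∣ c - D ∣ ≡⟨ cong (D +_) (m≤n⇒∣n-m∣≡n∸m D≤c) ⟩
  D + (c ∸ D)   ≡⟨ m+[n∸m]≡n D≤c ⟩
  c             ∎
  where open ≡-Reasoning

right-distance-injective : ∀ {c c' D} → D ≤ c → D ≤ c' → ∣ c - D ∣ ≡ ∣ c' - D ∣ → c ≡ c'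
right-distance-injective {c} {c'} {D} D≤c D≤c' eq = begin
  c             ≡⟨ right-distance D≤c ⟨
  D + ∣ c - D ∣  ≡⟨ cong (D +_) eq ⟩
  D + ∣ c' - D ∣ ≡⟨ right-distance D≤c' ⟩
  c'            ∎
  where open ≡-Reasoning

distance-of-right-shift : ∀ D k → ∣ D + k - D ∣ ≡ k
distance-of-right-shift D k = trans (∣-∣-comm (D + k) D) (∣m-m+n∣≡n D k)

-- A box (r : c) left of the centre with c < g + r has level D - c + r > D - g,
-- while a row-1 box in a column g < c' < D has level D - c' + 1 ≤ D - g; so
-- a row-1 box beyond column g with the same level lies right of the centre.
row1-partner-is-right : ∀ D g r c c' → c < D → c < g + r → g < c' →
  ∣ c - D ∣ + r ≡ ∣ c' - D ∣ + 1 → D ≤ c'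
row1-partner-is-right D g r c c' c<D c<g+r g<c' same-level with D ≤? c'
... | yes D≤c' = D≤c'
... | no D≰c' = ⊥-elim (<-irrefl refl g+r<g+r)
  where
  open ≡-Reasoning
  shifted : D + (r + c') ≡ D + (1 + c)
  shifted = begin
    D + (r + c')                   ≡⟨ cong (_+ (r + c')) (left-distance (<⇒≤ c<D)) ⟨
    (∣ c - D ∣ + c) + (r + c')     ≡⟨ interchange ∣ c - D ∣ c r c' ⟩
    (∣ c - D ∣ + r) + (c + c')     ≡⟨ cong₂ _+_ same-level (+-comm c c') ⟩
    (∣ c' - D ∣ + 1) + (c' + c)    ≡⟨ interchange ∣ c' - D ∣ 1 c' c ⟩
    (∣ c' - D ∣ + c') + (1 + c)    ≡⟨ cong (_+ (1 + c)) (left-distance (<⇒≤ (≰⇒> D≰c'))) ⟩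
    D + (1 + c)                    ∎
  c'+r≡1+c : c' + r ≡ suc c
  c'+r≡1+c = trans (+-comm c' r) (+-cancelˡ-≡ D (r + c') (1 + c) shifted)
  g+r<g+r : g + r < g + r
  g+r<g+r = ≤-trans (subst (suc (g + r) ≤_) c'+r≡1+c (+-monoˡ-< r g<c')) c<g+r

partition-box-bound : ∀ {a b r c} → b ≤ a → (r , c) ∈ₛ (a , b) → c < a + r
partition-box-bound {a} {r = 1} {c} b≤a (_ , c≤a) = subst (c <_) (+-comm 1 a) (s≤s c≤a)
partition-box-bound {a} {r = 2} b≤a (_ , c≤b) = ≤-<-trans (≤-trans c≤b b≤a) (m<m+n a (s≤s z≤n))
partition-box-bound {r = 0} _ (s≤s _ , ())
partition-box-bound {r = suc (suc (suc _))} _ (s≤s _ , ())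

second-row-below-centre : ∀ {a b D} → b ≤ a → a + b < D + D → b < D
second-row-below-centre {a} {b} {D} b≤a a+b<2D with D ≤? b
... | no D≰b = ≰⇒> D≰b
... | yes D≤b = ⊥-elim (<-irrefl refl
        (<-≤-trans a+b<2D (≤-trans (+-mono-≤ D≤b D≤b) (+-monoˡ-≤ b b≤a))))

-- The two size bounds g + b < 2D ≤ p + (g + b) place the columns D + a and
-- D + a + 1, a = |b - D|, inside the window (g , g + p + 1] of new boxes.
window-bounds : ∀ {g p b D} → b ≤ D → g + b < D + D → D + D ≤ p + (g + b) →
  g < D + ∣ b - D ∣ × D + ∣ b - D ∣ < g + p + 1
window-bounds {g} {p} {b} {D} b≤D below above =
  +-cancelʳ-< b g (D + a) (subst (g + b <_) (sym level-sum) below) ,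
  subst (suc (D + a) ≤_) (trans (cong suc (+-comm p g)) (+-comm 1 (g + p))) (s≤s D+a≤p+g)
  where
  a = ∣ b - D ∣
  level-sum : (D + a) + b ≡ D + D
  level-sum = trans (+-assoc D a b) (cong (D +_) (left-distance b≤D))
  D+a≤p+g : D + a ≤ p + g
  D+a≤p+g = +-cancelʳ-≤ b (D + a) (p + g) (subst₂ _≤_ (sym level-sum) (sym (+-assoc p g b)) above)

module Shapes (g q h : ℕ) (g≤q : g ≤ q) where
  γ δ μ : Shape
  γ = (g , suc h)
  δ = (q , h)
  μ = (g , h)

  new-box : ∀ {r c} → (r , c) ∈ δ ∖ γ → r ≡ 1 × g < c
  new-box {1} ((1≤c , c≤q) , c∉γ) = refl , ≰⇒> (λ c≤g → c∉γ (1≤c , c≤g))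
  new-box {2} ((1≤c , c≤h) , c∉γ) = ⊥-elim (c∉γ (1≤c , m≤n⇒m≤1+n c≤h))
  new-box {0} ((s≤s _ , ()) , _)
  new-box {suc (suc (suc _))} ((s≤s _ , ()) , _)

  row1-new-box : ∀ {c} → g < c → c ≤ q → (1 , c) ∈ δ ∖ γ
  row1-new-box g<c c≤q = (≤-trans (s≤s z≤n) g<c , c≤q) , λ (_ , c≤g) → <⇒≱ g<c c≤g

  lost-box : ∀ {r c} → (r , c) ∈ γ ∖ δ → (r , c) ≡ (2 , suc h)
  lost-box {1} ((1≤c , c≤g) , c∉δ) = ⊥-elim (c∉δ (1≤c , ≤-trans c≤g g≤q))
  lost-box {2} ((1≤c , c≤h+1) , c∉δ) = cong (2 ,_) (≤-antisym c≤h+1 (≰⇒> λ c≤h → c∉δ (1≤c , c≤h)))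
  lost-box {0} ((s≤s _ , ()) , _)
  lost-box {suc (suc (suc _))} ((s≤s _ , ()) , _)

  removed-box : ∀ {r c} → (r , c) ∈ γ ∖ μ → c ≡ suc h
  removed-box {1} (c∈γ , c∉μ) = ⊥-elim (c∉μ c∈γ)
  removed-box {2} ((1≤c , c≤h+1) , c∉μ) = ≤-antisym c≤h+1 (≰⇒> λ c≤h → c∉μ (1≤c , c≤h))
  removed-box {0} ((s≤s _ , ()) , _)
  removed-box {suc (suc (suc _))} ((s≤s _ , ()) , _)

  added-box : ∀ {r c} → (r , c) ∈ δ ∖ μ → r ≡ 1
  added-box {1} _ = refl
  added-box {2} (c∈δ , c∉μ) = ⊥-elim (c∉μ c∈δ)
  added-box {0} ((s≤s _ , ()) , _)
  added-box {suc (suc (suc _))} ((s≤s _ , ()) , _)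

  μ⊆γ : μ ⊆ₛ γ
  μ⊆γ (1 , c) c∈μ = c∈μ
  μ⊆γ (2 , c) (1≤c , c≤h) = 1≤c , m≤n⇒m≤1+n c≤h
  μ⊆γ (0 , c) (s≤s _ , ())
  μ⊆γ (suc (suc (suc _)) , c) (s≤s _ , ())

  μ⊆δ : μ ⊆ₛ δ
  μ⊆δ (1 , c) (1≤c , c≤g) = 1≤c , ≤-trans c≤g g≤q
  μ⊆δ (2 , c) c∈μ = c∈μ
  μ⊆δ (0 , c) (s≤s _ , ())
  μ⊆δ (suc (suc (suc _)) , c) (s≤s _ , ())

  γ∖μ-vertical : VStrip γ μ
  γ∖μ-vertical r c c' b b' = trans (removed-box {r} {c} b) (sym (removed-box {r} {c'} b'))

  δ∖μ-horizontal : HStrip δ μ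
  δ∖μ-horizontal r r' c b b' = trans (added-box b) (sym (added-box b'))

  -- With centre column D = E + 1 (so n = E + 2): a box of the partition γ
  -- left of the centre is related to at most one box of δ ∖ γ.
  module Centre (E : ℕ) (h+1≤g : suc h ≤ g) where
    D = suc E

    -- Both partners lie in row 1 right of the centre, where equal levels
    -- force equal columns.
    partner-unique : ∀ {r c} → (r , c) ∈ₛ γ → c < D → ∀ x y → x ∈ δ ∖ γ → y ∈ δ ∖ γ →
      Related (suc D) (r , c) x → Related (suc D) (r , c) y → x ≡ y
    partner-unique {r} {c} c∈γ c<D (rx , cx) (ry , cy) x-new y-new rel-x rel-y
      with new-box {rx} x-new | new-box {ry} y-new
    ... | refl , g<cx | refl , g<cy = cong (1 ,_) (right-distance-injective D≤cx D≤cy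
          (+-cancelʳ-≡ 1 ∣ cx - D ∣ ∣ cy - D ∣ (trans (sym rel-x) rel-y)))
      where
      c<g+r = partition-box-bound h+1≤g c∈γ
      D≤cx = row1-partner-is-right D g r c cx c<D c<g+r g<cx rel-x
      D≤cy = row1-partner-is-right D g r c cy c<D c<g+r g<cy rel-y

    column-box∈γ : ∀ {k} → k ≤ 1 → (suc k , suc h) ∈ₛ γ
    column-box∈γ z≤n = s≤s z≤n , h+1≤g
    column-box∈γ (s≤s z≤n) = s≤s z≤n , ≤-refl

    condition1 : Cond1 (suc D) γ δ
    condition1 r c c∈γ c≤E _ = partner-unique c∈γ (s≤s c≤E)

    -- Condition (2): the lost box (2 : h + 1) and the box (1 : h + 1) above
    -- it are related to the row-1 boxes in columns D + a + 1 and D + a,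
    -- a = |h + 1 - D|, provided these columns lie in the window (g , q].
    module Window (h+1<D : suc h < D) (g<D+a : g < D + ∣ suc h - D ∣)
                  (D+a<q : D + ∣ suc h - D ∣ < q) where
      a = ∣ suc h - D ∣

      partner : ∀ k → k ≤ 1 → Σ Box λ x →
        (x ∈ δ ∖ γ × Related (suc D) (suc k , suc h) x × row x ≡ 1) ×
        (∀ y → y ∈ δ ∖ γ → Related (suc D) (suc k , suc h) y → y ≡ x)
      partner k k≤1 = x , (x-new , related , refl) , unique
        where
        x : Box
        x = (1 , D + (a + k))
        x-new : x ∈ δ ∖ γ
        x-new = row1-new-box (<-≤-trans g<D+a (+-monoʳ-≤ D (m≤m+n a k))) in-window
          where
          open ≤-Reasoning
          in-window : D + (a + k) ≤ q
          in-window = begin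
            D + (a + k) ≤⟨ +-monoʳ-≤ D (+-monoʳ-≤ a k≤1) ⟩
            D + (a + 1) ≡⟨ cong (D +_) (+-comm a 1) ⟩
            D + suc a   ≡⟨ +-suc D a ⟩
            suc (D + a) ≤⟨ D+a<q ⟩
            q           ∎
        related : Related (suc D) (suc k , suc h) x
        related = begin
          a + suc k                  ≡⟨ +-suc a k ⟩
          suc (a + k)                ≡⟨ +-comm 1 (a + k) ⟩
          (a + k) + 1                ≡⟨ cong (_+ 1) (distance-of-right-shift D (a + k)) ⟨
          ∣ D + (a + k) - D ∣ + 1     ∎
          where open ≡-Reasoning
        unique : ∀ y → y ∈ δ ∖ γ → Related (suc D) (suc k , suc h) y → y ≡ x
        unique y y-new rel-y = partner-unique (column-box∈γ k≤1) h+1<D y x y-new x-new rel-y related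

      condition2 : Cond2 (suc D) γ δ
      condition2 = 1 , λ (r , c) b-lost → partner-of (lost-box {r} {c} b-lost)
        where
        partner-of : ∀ {b} → b ≡ (2 , suc h) → ∀ b' → SelfOrAbove b b' → Σ Box λ x →
          (x ∈ δ ∖ γ × Related (suc D) b' x × row x ≡ 1) ×
          (∀ y → y ∈ δ ∖ γ → Related (suc D) b' y → y ≡ x)
        partner-of refl .(2 , suc h) (inj₁ refl) = partner 1 ≤-refl
        partner-of refl .(1 , suc h) (inj₂ (_ , refl)) = partner 0 z≤n

twice-centre : ∀ E → suc (2 * suc (suc E) ∸ 3) ≡ suc E + suc E
twice-centre E rewrite +-identityʳ E | +-suc E (suc E) = refl

lemma4p4 : (n p g₁ g₂ : ℕ) → 3 ≤ n → 1 ≤ p → p ≤ 2 * n ∸ 2 →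
    InP n (g₁ , g₂) → g₁ + g₂ ≤ 2 * n ∸ 3 → 2 * n ∸ 3 < p + (g₁ + g₂) →
    1 ≤ g₂ → InP n (g₁ + p + 1 , g₂ ∸ 1) →
    Arrow n p (g₁ , g₂) (g₁ + p + 1 , g₂ ∸ 1)
lemma4p4 (suc zero) _ _ _ (s≤s ()) _ _ _ _ _ _ _
lemma4p4 (suc (suc E)) p g₁ (suc h) _ _ _ (h+1≤g , _) small large _ _ =
  size-eq , μ , ≤-trans (n≤1+n h) h+1≤g , μ⊆γ , γ∖μ-vertical , removed-in-first-cols ,
  μ⊆δ , δ∖μ-horizontal , condition1 , condition2
  where
  open Shapes g₁ (g₁ + p + 1) h (≤-trans (m≤m+n g₁ p) (m≤m+n (g₁ + p) 1))
  open Centre E h+1≤g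
  below : g₁ + suc h < D + D
  below = subst (g₁ + suc h <_) (twice-centre E) (s≤s small)
  above : D + D ≤ p + (g₁ + suc h)
  above = subst (_≤ p + (g₁ + suc h)) (twice-centre E) large
  h+1<D : suc h < D
  h+1<D = second-row-below-centre h+1≤g below
  window : g₁ < D + ∣ suc h - D ∣ × D + ∣ suc h - D ∣ < g₁ + p + 1
  window = window-bounds {p = p} (<⇒≤ h+1<D) below above
  open Window h+1<D (proj₁ window) (proj₂ window)
  removed-in-first-cols : InFirstCols E γ μ
  removed-in-first-cols (r , c) removed rewrite removed-box {r} {c} removed = ≤-pred h+1<D
  size-eq : size δ ≡ size γ + p
  size-eq = solve 3 (λ g q k → (g :+ q :+ con 1) :+ k := (g :+ (con 1 :+ k)) :+ q) refl g₁ p h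
    where open +-*-Solver
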